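{- Let $c,d\in\mathbb{N}$. There is a constant $C=C(c,d)$ such that for every prime finite field $\mathbb{F}$, every $n$, and all polynomials $P_1,\ldots,P_c:\mathbb{F}^n\to\mathbb{F}$ of degree $d$: if $P_1,\ldots,P_c$ have at least one common zero in $\mathbb{F}^n$, then they have at least $|\mathbb{F}|^{n-C}$ common zeros in $\mathbb{F}^n$. -}

module Defs where

open import Data.Nat using (ℕ; zero; suc; _+_; _*_; _^_; _≤_)
open import Data.Nat.Divisibility using (_∣_; _∣?_)
open import Data.Fin using (Fin; toℕ)
open import Data.Fin.Base using () renaming (zero to fzero; suc to fsuc)
open import Data.Vec using (Vec; []; _∷_; zipWith)
open import Data.List using (List; []; _∷_; [_]; map; concatMap; allFin; length)
open import Data.Nat.ListAction using (sum)
open import Data.Product using (_×_; _,_; proj₂)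
open import Data.Bool using (Bool; true; false; _∧_)
open import Relation.Nullary.Decidable using (⌊_⌋)
open import Data.List.Relation.Unary.All using (All)

-- A polynomial in n variables over ℕ-coefficients (interpreted in 𝔽_p by
-- reduction mod p): a finite list of monomials (coefficient , exponent vector).
Monomial : ℕ → Set
Monomial n = ℕ × Vec ℕ n

Poly : ℕ → Set
Poly n = List (Monomial n)

totalDeg : ∀ {n} → Vec ℕ n → ℕ
totalDeg []       = 0
totalDeg (e ∷ es) = e + totalDeg es

DegreeAtMost : ∀ {n} → ℕ → Poly n → Set
DegreeAtMost d P = All (λ m → totalDeg (proj₂ m) ≤ d) P

prodV : ∀ {n} → Vec ℕ n → ℕ
prodV []       = 1
prodV (x ∷ xs) = x * prodV xs

-- evaluation at a point of 𝔽_p^n = (Fin p)^n, as a natural number (not yet reduced mod p)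
evalMono : ∀ {p n} → Monomial n → Vec (Fin p) n → ℕ
evalMono (a , e) x = a * prodV (zipWith (λ xi ei → toℕ xi ^ ei) x e)

evalℕ : ∀ {p n} → Poly n → Vec (Fin p) n → ℕ
evalℕ P x = sum (map (λ m → evalMono m x) P)

IsZero : ∀ {p n} → Poly n → Vec (Fin p) n → Set
IsZero {p} P x = p ∣ evalℕ P x

isZeroᵇ : ∀ {p n} → Poly n → Vec (Fin p) n → Bool
isZeroᵇ {p} P x = ⌊ p ∣? evalℕ P x ⌋

IsCommonZero : ∀ {p n c} → (Fin c → Poly n) → Vec (Fin p) n → Set
IsCommonZero {c = c} Ps x = (j : Fin c) → IsZero (Ps j) x

allᵇ : ∀ {c} → (Fin c → Bool) → Bool
allᵇ {zero}  f = true
allᵇ {suc c} f = f fzero ∧ allᵇ (λ j → f (fsuc j))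

isCommonZeroᵇ : ∀ {p n c} → (Fin c → Poly n) → Vec (Fin p) n → Bool
isCommonZeroᵇ Ps x = allᵇ (λ j → isZeroᵇ (Ps j) x)

allPoints : (p n : ℕ) → List (Vec (Fin p) n)
allPoints p zero    = [ [] ]
allPoints p (suc n) = concatMap (λ i → map (i ∷_) (allPoints p n)) (allFin p)

countTrue : ∀ {A : Set} → (A → Bool) → List A → ℕ
countTrue f []       = 0
countTrue f (x ∷ xs) with f x
... | true  = suc (countTrue f xs)
... | false = countTrue f xs

numCommonZeros : (p n c : ℕ) → (Fin c → Poly n) → ℕ
numCommonZeros p n c Ps = countTrue (isCommonZeroᵇ {p} Ps) (allPoints p n)

module Submission where

-- Write p = q + 1 and D = c·d, and let N count the common zeros in 𝔽ₚᵐ of a system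
-- having a common zero z. We show N ≥ q·p^(m−D−1) + 1 whenever D < m, by induction on m;
-- so C = D + 1 works.
-- If m = D + 1, Chevalley–Warning gives p ∣ N, hence N ≥ p. Otherwise restrict the system
-- to each of the p^(m−1) hyperplanes x₀ = z₀ + a·(y − z′) through z = (z₀, z′): each
-- restriction has m − 1 variables, the same degrees and the common zero z′, so by induction
-- it has at least q·p^e + 1 common zeros. The point z lies on all of these hyperplanes and
-- any other point on at most p^(m−2) of them, so p^(m−1)(q·p^e + 1) ≤ p^(m−2)(N + q), that
-- is N ≥ q·p^(e+1) + 1.
-- Chevalley–Warning is the classical argument: modulo p, ∏ⱼ (1 − Pⱼ^(p−1)) is the indicator
-- of the common zeros (Fermat), its degree is below m(p − 1), and over 𝔽ₚᵐ every monomial of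
-- degree below m(p − 1) sums to 0 because Σ_{t<p} t^e ≡ 0 for e < p − 1.

open import Defs
import Algebra.Properties.CommutativeSemigroup as CommSemigroupProperties
open import Data.Bool using (Bool; true; false; _∧_)
open import Data.Fin using (Fin; toℕ; zero; suc)
open import Data.Fin.Properties using (_≟_; suc-injective; toℕ-fromℕ<; toℕ-injective; toℕ<n)
open import Data.List using (List; []; _∷_; [_]; _++_; map; concatMap; allFin; upTo; length)
open import Data.List.Properties using (map-tabulate; map-upTo; length-tabulate; upTo-∷ʳ)
open import Data.List.Relation.Unary.All as All using (All; []; _∷_)
open import Data.List.Relation.Unary.All.Properties using (++⁺; concat⁺; gmap⁺; applyUpTo⁺₁)
open import Data.Nat
  using (ℕ; zero; suc; _+_; _*_; _^_; _∸_; _%_; _/_; _≤_; _<_; _<?_; z≤n; s≤s; NonZero; ≢-nonZero; >-nonZero)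
open import Data.Nat.Combinatorics
  using (_C_; nCk+nC[k+1]≡[n+1]C[k+1]; nCn≡1; nC1≡n; k>n⇒nCk≡0; nCk≡nC[n∸k])
open import Data.Nat.DivMod
open import Data.Nat.Divisibility
  using ( _∣_; _∣?_; divides; _∣0; ∣-refl; ∣m∣n⇒∣m+n; ∣m+n∣m⇒∣n; m∣m*n; ∣n⇒∣m*n; ∣m⇒∣m*n; ∣⇒≤
        ; m%n≡0⇒n∣m; n∣m⇒m%n≡0)
open import Data.Nat.Induction using (<-rec)
open import Data.Nat.ListAction using (sum)
open import Data.Nat.Primality using (Prime; euclidsLemma; ¬prime[0]; ¬prime[1])
open import Data.Nat.Properties hiding (_≟_; suc-injective)
open import Data.Nat.Tactic.RingSolver using (solve-∀)
open import Data.Product using (_,_; proj₁; proj₂; ∃-syntax)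
open import Data.Sum using (inj₁; inj₂)
open import Data.Vec as Vec using (Vec; []; _∷_; zipWith; replicate)
open import Data.Vec.Properties using (≡-dec)
open import Data.Vec.Relation.Binary.Pointwise.Inductive as Pointwise using (Pointwise; []; _∷_)
open import Data.Vec.Relation.Unary.Any using (Any; here; there)
open import Function using (_∘_)
open import Level using (0ℓ)
open import Relation.Binary.Bundles using (Setoid)
open import Relation.Binary.Definitions using (DecidableEquality)
open import Relation.Binary.PropositionalEquality hiding ([_])
import Relation.Binary.Reasoning.Setoid as SetoidReasoning
open import Relation.Nullary.Decidable using (does; yes; no; ⌊_⌋; dec-true; dec-false; isYes≗does)
open import Relation.Nullary.Negation using (¬_; contradiction)

module +-CS = CommSemigroupProperties +-commutativeSemigroup
module *-CS = CommSemigroupProperties *-commutativeSemigroup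

-- Finite sums

∑ : {A : Set} → List A → (A → ℕ) → ℕ
∑ xs f = sum (map f xs)

-- The body of ∑[ x ∈ xs ] extends over _+_ and _*_.
infix 5 ∑
syntax ∑ xs (λ x → e) = ∑[ x ∈ xs ] e

module _ {A : Set} where

  ∑-cong : (xs : List A) {f g : A → ℕ} → (∀ x → f x ≡ g x) → ∑ xs f ≡ ∑ xs g
  ∑-cong []       f≗g = refl
  ∑-cong (x ∷ xs) f≗g = cong₂ _+_ (f≗g x) (∑-cong xs f≗g)

  ∑-mono-≤ : (xs : List A) {f g : A → ℕ} → (∀ x → f x ≤ g x) → ∑ xs f ≤ ∑ xs g
  ∑-mono-≤ []       f≤g = z≤n
  ∑-mono-≤ (x ∷ xs) f≤g = +-mono-≤ (f≤g x) (∑-mono-≤ xs f≤g)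

  ∑-++ : (xs ys : List A) (f : A → ℕ) → ∑ (xs ++ ys) f ≡ ∑ xs f + ∑ ys f
  ∑-++ []       ys f = refl
  ∑-++ (x ∷ xs) ys f = trans (cong (f x +_) (∑-++ xs ys f)) (sym (+-assoc (f x) _ _))

  ∑-+ : (xs : List A) (f g : A → ℕ) → ∑[ x ∈ xs ] f x + g x ≡ ∑ xs f + ∑ xs g
  ∑-+ []       f g = refl
  ∑-+ (x ∷ xs) f g = trans (cong (f x + g x +_) (∑-+ xs f g)) (+-CS.interchange (f x) (g x) _ _)

  ∑-*ˡ : (xs : List A) (c : ℕ) (f : A → ℕ) → ∑[ x ∈ xs ] c * f x ≡ c * ∑ xs f
  ∑-*ˡ []       c f = sym (*-zeroʳ c)
  ∑-*ˡ (x ∷ xs) c f = trans (cong (c * f x +_) (∑-*ˡ xs c f)) (sym (*-distribˡ-+ c (f x) _))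

  ∑-*ʳ : (xs : List A) (c : ℕ) (f : A → ℕ) → ∑[ x ∈ xs ] f x * c ≡ ∑ xs f * c
  ∑-*ʳ []       c f = refl
  ∑-*ʳ (x ∷ xs) c f = trans (cong (f x * c +_) (∑-*ʳ xs c f)) (sym (*-distribʳ-+ c (f x) _))

  ∑-const : (xs : List A) (c : ℕ) → ∑[ _ ∈ xs ] c ≡ length xs * c
  ∑-const []       c = refl
  ∑-const (x ∷ xs) c = cong (c +_) (∑-const xs c)

  ∑-∣ : ∀ {d} (xs : List A) (f : A → ℕ) → All (λ x → d ∣ f x) xs → d ∣ ∑ xs f
  ∑-∣ []       f []         = _ ∣0
  ∑-∣ (x ∷ xs) f (d∣ ∷ d∣s) = ∣m∣n⇒∣m+n d∣ (∑-∣ xs f d∣s)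

module _ {A B : Set} where

  ∑-map : (h : A → B) (xs : List A) (f : B → ℕ) → ∑ (map h xs) f ≡ ∑[ x ∈ xs ] f (h x)
  ∑-map h []       f = refl
  ∑-map h (x ∷ xs) f = cong (f (h x) +_) (∑-map h xs f)

  ∑-concatMap : (g : A → List B) (xs : List A) (f : B → ℕ) →
                ∑ (concatMap g xs) f ≡ ∑[ x ∈ xs ] ∑ (g x) f
  ∑-concatMap g []       f = refl
  ∑-concatMap g (x ∷ xs) f =
    trans (∑-++ (g x) (concatMap g xs) f) (cong (∑ (g x) f +_) (∑-concatMap g xs f))

  ∑-swap : (xs : List A) (ys : List B) (f : A → B → ℕ) →
           ∑[ x ∈ xs ] ∑[ y ∈ ys ] f x y ≡ ∑[ y ∈ ys ] ∑[ x ∈ xs ] f x y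
  ∑-swap []       ys f = sym (trans (∑-const ys 0) (*-zeroʳ (length ys)))
  ∑-swap (x ∷ xs) ys f =
    trans (cong (∑ ys (f x) +_) (∑-swap xs ys f)) (sym (∑-+ ys (f x) (λ y → ∑[ x ∈ xs ] f x y)))

𝟙 : Bool → ℕ
𝟙 true  = 1
𝟙 false = 0

𝟙-∧ : ∀ a b → 𝟙 (a ∧ b) ≡ 𝟙 a * 𝟙 b
𝟙-∧ true  b = sym (+-identityʳ (𝟙 b))
𝟙-∧ false b = refl

𝟙≤1 : ∀ b → 𝟙 b ≤ 1
𝟙≤1 true  = ≤-refl
𝟙≤1 false = z≤n

countTrue≡∑𝟙 : {A : Set} (f : A → Bool) (xs : List A) → countTrue f xs ≡ ∑[ x ∈ xs ] 𝟙 (f x)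
countTrue≡∑𝟙 f []       = refl
countTrue≡∑𝟙 f (x ∷ xs) with f x
... | true  = cong suc (countTrue≡∑𝟙 f xs)
... | false = countTrue≡∑𝟙 f xs

∑-zero : {A : Set} (xs : List A) → ∑[ _ ∈ xs ] 0 ≡ 0
∑-zero xs = trans (∑-const xs 0) (*-zeroʳ (length xs))

∑-upTo-suc : ∀ n (f : ℕ → ℕ) → ∑ (upTo (suc n)) f ≡ f 0 + (∑[ t ∈ upTo n ] f (suc t))
∑-upTo-suc n f = cong (f 0 +_) (trans (cong (λ ts → ∑ ts f) (sym (map-upTo suc n))) (∑-map suc (upTo n) f))

∑-upTo-sucʳ : ∀ n (f : ℕ → ℕ) → ∑ (upTo (suc n)) f ≡ ∑ (upTo n) f + f n
∑-upTo-sucʳ n f = trans (cong (λ ts → ∑ ts f) (sym (upTo-∷ʳ n)))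
                        (trans (∑-++ (upTo n) [ n ] f) (cong (∑ (upTo n) f +_) (+-identityʳ (f n))))

∑-allFin-suc : ∀ n (f : Fin (suc n) → ℕ) → ∑ (allFin (suc n)) f ≡ f zero + (∑[ i ∈ allFin n ] f (suc i))
∑-allFin-suc n f =
  cong (λ xs → f zero + sum xs) (trans (map-tabulate suc f) (sym (map-tabulate (λ i → i) (f ∘ suc))))

∑-allFin-toℕ : ∀ n (f : ℕ → ℕ) → ∑[ i ∈ allFin n ] f (toℕ i) ≡ ∑ (upTo n) f
∑-allFin-toℕ zero    f = refl
∑-allFin-toℕ (suc n) f = begin
  ∑[ i ∈ allFin (suc n) ] f (toℕ i)          ≡⟨ ∑-allFin-suc n (f ∘ toℕ) ⟩
  f 0 + (∑[ i ∈ allFin n ] f (suc (toℕ i)))  ≡⟨ cong (f 0 +_) (∑-allFin-toℕ n (f ∘ suc)) ⟩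
  f 0 + (∑[ t ∈ upTo n ] f (suc t))          ≡⟨ ∑-upTo-suc n f ⟨
  ∑ (upTo (suc n)) f                         ∎
  where open ≡-Reasoning

∑-allFin-const : ∀ n c → ∑[ _ ∈ allFin n ] c ≡ n * c
∑-allFin-const n c = trans (∑-const (allFin n) c) (cong (_* c) (length-tabulate {n = n} (λ i → i)))

≟-true⇒≡ : ∀ {n} (i j : Fin n) → does (i ≟ j) ≡ true → i ≡ j
≟-true⇒≡ i j i≟j with i ≟ j
... | yes i≡j = i≡j

∑-allFin-δ : ∀ {n} (j : Fin n) (h : Fin n → ℕ) → ∑[ i ∈ allFin n ] 𝟙 (does (i ≟ j)) * h i ≡ h j
∑-allFin-δ {suc n} zero h = begin
  ∑[ i ∈ allFin (suc n) ] 𝟙 (does (i ≟ zero)) * h i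
    ≡⟨ ∑-allFin-suc n (λ i → 𝟙 (does (i ≟ zero)) * h i) ⟩
  h zero + 0 + (∑[ _ ∈ allFin n ] 0)
    ≡⟨ cong₂ _+_ (+-identityʳ (h zero)) (∑-zero (allFin n)) ⟩
  h zero + 0
    ≡⟨ +-identityʳ (h zero) ⟩
  h zero ∎
  where open ≡-Reasoning
∑-allFin-δ {suc n} (suc j) h =
  trans (∑-allFin-suc n (λ i → 𝟙 (does (i ≟ suc j)) * h i)) (∑-allFin-δ j (h ∘ suc))

∑-allFin-𝟙≤1 : ∀ n (f : Fin n → Bool) → (∀ i j → f i ≡ true → f j ≡ true → i ≡ j) →
               ∑[ i ∈ allFin n ] 𝟙 (f i) ≤ 1
∑-allFin-𝟙≤1 zero    f f-inj = z≤n
∑-allFin-𝟙≤1 (suc n) f f-inj rewrite ∑-allFin-suc n (𝟙 ∘ f) with f zero in f0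
... | true  = ≤-reflexive (cong suc (trans (∑-cong (allFin n) rest-false) (∑-zero (allFin n))))
  where
  rest-false : ∀ i → 𝟙 (f (suc i)) ≡ 0
  rest-false i with f (suc i) in fi
  ... | true with () ← f-inj zero (suc i) f0 fi
  ... | false = refl
... | false = ∑-allFin-𝟙≤1 n (f ∘ suc) (λ i j fi fj → suc-injective (f-inj (suc i) (suc j) fi fj))

module _ {p : ℕ} where

  _≟ᵥ_ : ∀ {m} → DecidableEquality (Vec (Fin p) m)
  _≟ᵥ_ = ≡-dec _≟_

  ∑-allPoints-suc : ∀ m (f : Vec (Fin p) (suc m) → ℕ) →
    ∑ (allPoints p (suc m)) f ≡ ∑[ i ∈ allFin p ] ∑[ x ∈ allPoints p m ] f (i ∷ x)
  ∑-allPoints-suc m f =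
    trans (∑-concatMap _ (allFin p) f) (∑-cong (allFin p) (λ i → ∑-map (i ∷_) (allPoints p m) f))

  ∑-allPoints-const : ∀ m c → ∑[ _ ∈ allPoints p m ] c ≡ p ^ m * c
  ∑-allPoints-const zero    c = trans (+-identityʳ c) (sym (*-identityˡ c))
  ∑-allPoints-const (suc m) c = begin
    ∑[ _ ∈ allPoints p (suc m) ] c              ≡⟨ ∑-allPoints-suc m (λ _ → c) ⟩
    ∑[ _ ∈ allFin p ] ∑[ _ ∈ allPoints p m ] c  ≡⟨ ∑-cong (allFin p) (λ _ → ∑-allPoints-const m c) ⟩
    ∑[ _ ∈ allFin p ] p ^ m * c                 ≡⟨ ∑-allFin-const p (p ^ m * c) ⟩
    p * (p ^ m * c)                             ≡⟨ *-assoc p (p ^ m) c ⟨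
    p ^ suc m * c                               ∎
    where open ≡-Reasoning

  ∑-allPoints-δ : ∀ {m} (z : Vec (Fin p) m) (h : Vec (Fin p) m → ℕ) →
                  ∑[ y ∈ allPoints p m ] 𝟙 (does (y ≟ᵥ z)) * h y ≡ h z
  ∑-allPoints-δ [] h = trans (+-identityʳ _) (+-identityʳ (h []))
  ∑-allPoints-δ {suc m} (z₀ ∷ z) h = begin
    ∑[ y ∈ allPoints p (suc m) ] 𝟙 (does (y ≟ᵥ (z₀ ∷ z))) * h y
      ≡⟨ ∑-allPoints-suc m (λ y → 𝟙 (does (y ≟ᵥ (z₀ ∷ z))) * h y) ⟩
    ∑[ i ∈ allFin p ] ∑[ y ∈ allPoints p m ] 𝟙 (does (i ≟ z₀) ∧ does (y ≟ᵥ z)) * h (i ∷ y)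
      ≡⟨ ∑-cong (allFin p) (λ i → trans (∑-cong (allPoints p m) (λ y → split i y))
           (∑-*ˡ (allPoints p m) (𝟙 (does (i ≟ z₀))) (λ y → 𝟙 (does (y ≟ᵥ z)) * h (i ∷ y)))) ⟩
    ∑[ i ∈ allFin p ] 𝟙 (does (i ≟ z₀)) * (∑[ y ∈ allPoints p m ] 𝟙 (does (y ≟ᵥ z)) * h (i ∷ y))
      ≡⟨ ∑-cong (allFin p) (λ i → cong (𝟙 (does (i ≟ z₀)) *_) (∑-allPoints-δ z (h ∘ (i ∷_)))) ⟩
    ∑[ i ∈ allFin p ] 𝟙 (does (i ≟ z₀)) * h (i ∷ z)
      ≡⟨ ∑-allFin-δ z₀ (λ i → h (i ∷ z)) ⟩
    h (z₀ ∷ z) ∎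
    where
    open ≡-Reasoning
    split : ∀ i y → 𝟙 (does (i ≟ z₀) ∧ does (y ≟ᵥ z)) * h (i ∷ y)
                  ≡ 𝟙 (does (i ≟ z₀)) * (𝟙 (does (y ≟ᵥ z)) * h (i ∷ y))
    split i y = trans (cong (_* h (i ∷ y)) (𝟙-∧ (does (i ≟ z₀)) (does (y ≟ᵥ z))))
                      (*-assoc (𝟙 (does (i ≟ z₀))) _ _)

allᵇ-cong : ∀ {c} {f g : Fin c → Bool} → (∀ j → f j ≡ g j) → allᵇ f ≡ allᵇ g
allᵇ-cong {zero}  f≗g = refl
allᵇ-cong {suc c} f≗g = cong₂ _∧_ (f≗g zero) (allᵇ-cong (f≗g ∘ suc))

allᵇ-true : ∀ {c} (f : Fin c → Bool) → (∀ j → f j ≡ true) → allᵇ f ≡ true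
allᵇ-true {zero}  f f≡true = refl
allᵇ-true {suc c} f f≡true = cong₂ _∧_ (f≡true zero) (allᵇ-true (f ∘ suc) (f≡true ∘ suc))

IsCommonZero⇒isCommonZeroᵇ : ∀ {p n c} (Ps : Fin c → Poly n) (x : Vec (Fin p) n) →
  IsCommonZero {p} Ps x → isCommonZeroᵇ {p} Ps x ≡ true
IsCommonZero⇒isCommonZeroᵇ {p} Ps x x-zero =
  allᵇ-true _ (λ j → trans (isYes≗does (p ∣? evalℕ (Ps j) x)) (dec-true (p ∣? evalℕ (Ps j) x) (x-zero j)))

-- Polynomials

toℕs : ∀ {p n} → Vec (Fin p) n → Vec ℕ n
toℕs = Vec.map toℕ

prodV-^-replicate-0 : ∀ {n} (v : Vec ℕ n) → prodV (zipWith _^_ v (replicate n 0)) ≡ 1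
prodV-^-replicate-0 []       = refl
prodV-^-replicate-0 (x ∷ xs) = cong (1 *_) (prodV-^-replicate-0 xs)

totalDeg-replicate-0 : ∀ n → totalDeg (replicate n 0) ≡ 0
totalDeg-replicate-0 zero    = refl
totalDeg-replicate-0 (suc n) = totalDeg-replicate-0 n

module _ {n : ℕ} where

  evalMonomial : Monomial n → Vec ℕ n → ℕ
  evalMonomial (a , e) v = a * prodV (zipWith _^_ v e)

  eval : Poly n → Vec ℕ n → ℕ
  eval P v = ∑[ m ∈ P ] evalMonomial m v

  evalℕ≡eval : ∀ {p} (P : Poly n) (x : Vec (Fin p) n) → evalℕ P x ≡ eval P (toℕs x)
  evalℕ≡eval P x = ∑-cong P (λ (a , e) → cong (λ v → a * prodV v) (zipWith-map x e))
    where
    zipWith-map : ∀ {p m} (x : Vec (Fin p) m) (e : Vec ℕ m) →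
      zipWith (λ xᵢ eᵢ → toℕ xᵢ ^ eᵢ) x e ≡ zipWith _^_ (toℕs x) e
    zipWith-map []       []       = refl
    zipWith-map (x ∷ xs) (e ∷ es) = cong (toℕ x ^ e ∷_) (zipWith-map xs es)

  eval-++ : ∀ P Q v → eval (P ++ Q) v ≡ eval P v + eval Q v
  eval-++ P Q v = ∑-++ P Q (λ m → evalMonomial m v)

  constᴾ : ℕ → Poly n
  constᴾ c = [ (c , replicate n 0) ]

  eval-constᴾ : ∀ c v → eval (constᴾ c) v ≡ c
  eval-constᴾ c v = trans (+-identityʳ _) (trans (cong (c *_) (prodV-^-replicate-0 v)) (*-identityʳ c))

  infixl 7 _·ᴾ_ _*ᴾ_
  infixr 8 _^ᴾ_

  _·ᴾ_ : ℕ → Poly n → Poly n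
  c ·ᴾ P = map (λ (a , e) → (c * a , e)) P

  eval-·ᴾ : ∀ c P v → eval (c ·ᴾ P) v ≡ c * eval P v
  eval-·ᴾ c P v = begin
    eval (c ·ᴾ P) v                  ≡⟨ ∑-map _ P (λ m → evalMonomial m v) ⟩
    ∑[ m ∈ P ] c * proj₁ m * prodV (zipWith _^_ v (proj₂ m))
                                     ≡⟨ ∑-cong P (λ (a , e) → *-assoc c a _) ⟩
    ∑[ m ∈ P ] c * evalMonomial m v  ≡⟨ ∑-*ˡ P c (λ m → evalMonomial m v) ⟩
    c * eval P v                     ∎
    where open ≡-Reasoning

  _*ᴹ_ : Monomial n → Monomial n → Monomial n
  (a , e) *ᴹ (b , f) = (a * b , zipWith _+_ e f)

  _*ᴾ_ : Poly n → Poly n → Poly n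
  P *ᴾ Q = concatMap (λ m → map (m *ᴹ_) Q) P

  eval-*ᴹ : ∀ m₁ m₂ v → evalMonomial (m₁ *ᴹ m₂) v ≡ evalMonomial m₁ v * evalMonomial m₂ v
  eval-*ᴹ (a , e) (b , f) v = trans (cong (a * b *_) (prodV-^-+ v e f)) (*-CS.interchange a b _ _)
    where
    prodV-^-+ : ∀ {m} (v e f : Vec ℕ m) →
      prodV (zipWith _^_ v (zipWith _+_ e f)) ≡ prodV (zipWith _^_ v e) * prodV (zipWith _^_ v f)
    prodV-^-+ []       []       []       = refl
    prodV-^-+ (x ∷ xs) (e ∷ es) (f ∷ fs) =
      trans (cong₂ _*_ (^-distribˡ-+-* x e f) (prodV-^-+ xs es fs)) (*-CS.interchange (x ^ e) (x ^ f) _ _)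

  eval-*ᴾ : ∀ P Q v → eval (P *ᴾ Q) v ≡ eval P v * eval Q v
  eval-*ᴾ P Q v = begin
    eval (P *ᴾ Q) v
      ≡⟨ ∑-concatMap _ P (λ m → evalMonomial m v) ⟩
    ∑[ m ∈ P ] ∑[ m′ ∈ map (m *ᴹ_) Q ] evalMonomial m′ v
      ≡⟨ ∑-cong P (λ m → trans (∑-map (m *ᴹ_) Q _) (∑-cong Q (λ m′ → eval-*ᴹ m m′ v))) ⟩
    ∑[ m ∈ P ] ∑[ m′ ∈ Q ] evalMonomial m v * evalMonomial m′ v
      ≡⟨ ∑-cong P (λ m → ∑-*ˡ Q (evalMonomial m v) (λ m′ → evalMonomial m′ v)) ⟩
    ∑[ m ∈ P ] evalMonomial m v * eval Q v
      ≡⟨ ∑-*ʳ P (eval Q v) (λ m → evalMonomial m v) ⟩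
    eval P v * eval Q v ∎
    where open ≡-Reasoning

  _^ᴾ_ : Poly n → ℕ → Poly n
  P ^ᴾ zero  = constᴾ 1
  P ^ᴾ suc k = P *ᴾ P ^ᴾ k

  eval-^ᴾ : ∀ P k v → eval (P ^ᴾ k) v ≡ eval P v ^ k
  eval-^ᴾ P zero    v = eval-constᴾ 1 v
  eval-^ᴾ P (suc k) v = trans (eval-*ᴾ P (P ^ᴾ k) v) (cong (eval P v *_) (eval-^ᴾ P k v))

  deg-mono : ∀ {d d′} {P : Poly n} → d ≤ d′ → DegreeAtMost d P → DegreeAtMost d′ P
  deg-mono d≤d′ = All.map (λ le → ≤-trans le d≤d′)

  deg-constᴾ : ∀ c → DegreeAtMost 0 (constᴾ c)
  deg-constᴾ c = ≤-reflexive (totalDeg-replicate-0 n) ∷ []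

  deg-·ᴾ : ∀ {d} c {P : Poly n} → DegreeAtMost d P → DegreeAtMost d (c ·ᴾ P)
  deg-·ᴾ c = gmap⁺ (λ le → le)

  deg-*ᴾ : ∀ {d₁ d₂} {P Q : Poly n} →
           DegreeAtMost d₁ P → DegreeAtMost d₂ Q → DegreeAtMost (d₁ + d₂) (P *ᴾ Q)
  deg-*ᴾ degP degQ = concat⁺ (gmap⁺ (λ {(_ , e)} le → gmap⁺ (λ {(_ , f)} le′ →
    subst (_≤ _) (sym (totalDeg-zipWith-+ e f)) (+-mono-≤ le le′)) degQ) degP)
    where
    totalDeg-zipWith-+ : ∀ {m} (e f : Vec ℕ m) → totalDeg (zipWith _+_ e f) ≡ totalDeg e + totalDeg f
    totalDeg-zipWith-+ []       []       = refl
    totalDeg-zipWith-+ (x ∷ e) (y ∷ f) =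
      trans (cong (x + y +_) (totalDeg-zipWith-+ e f)) (+-CS.interchange x y _ _)

  deg-^ᴾ : ∀ {d} {P : Poly n} → DegreeAtMost d P → ∀ k → DegreeAtMost (k * d) (P ^ᴾ k)
  deg-^ᴾ degP zero    = deg-constᴾ 1
  deg-^ᴾ degP (suc k) = deg-*ᴾ degP (deg-^ᴾ degP k)

module _ {k : ℕ} (L : Poly k) where

  substMonomial : Monomial (suc k) → Poly k
  substMonomial (a , e₀ ∷ e) = L ^ᴾ e₀ *ᴾ [ (a , e) ]

  substFirst : Poly (suc k) → Poly k
  substFirst = concatMap substMonomial

  eval-substFirst : ∀ P v → eval (substFirst P) v ≡ eval P (eval L v ∷ v)
  eval-substFirst P v = trans (∑-concatMap substMonomial P (λ m → evalMonomial m v)) (∑-cong P eval-substMonomial)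
    where
    eval-substMonomial : ∀ m → eval (substMonomial m) v ≡ evalMonomial m (eval L v ∷ v)
    eval-substMonomial (a , e₀ ∷ e) = begin
      eval (L ^ᴾ e₀ *ᴾ [ (a , e) ]) v                     ≡⟨ eval-*ᴾ (L ^ᴾ e₀) [ (a , e) ] v ⟩
      eval (L ^ᴾ e₀) v * (a * prodV (zipWith _^_ v e) + 0) ≡⟨ cong₂ _*_ (eval-^ᴾ L e₀ v) (+-identityʳ _) ⟩
      eval L v ^ e₀ * (a * prodV (zipWith _^_ v e))        ≡⟨ *-CS.x∙yz≈y∙xz (eval L v ^ e₀) a _ ⟩
      a * (eval L v ^ e₀ * prodV (zipWith _^_ v e))        ∎
      where open ≡-Reasoning

  deg-substFirst : ∀ {d} {P : Poly (suc k)} → DegreeAtMost 1 L → DegreeAtMost d P → DegreeAtMost d (substFirst P)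
  deg-substFirst {d} degL degP = concat⁺ (gmap⁺ (λ {m} → deg-substMonomial m) degP)
    where
    deg-substMonomial : ∀ m → totalDeg (proj₂ m) ≤ d → DegreeAtMost d (substMonomial m)
    deg-substMonomial (a , e₀ ∷ e) le =
      deg-mono (subst (_≤ d) (cong (_+ totalDeg e) (sym (*-identityʳ e₀))) le)
               (deg-*ᴾ (deg-^ᴾ degL e₀) (≤-refl ∷ []))

dot : ∀ {n} → Vec ℕ n → Vec ℕ n → ℕ
dot []       []       = 0
dot (a ∷ as) (x ∷ xs) = a * x + dot as xs

affine : ∀ {n} → ℕ → Vec ℕ n → Poly n
affine c₀ []             = [ (c₀ , []) ]
affine c₀ (_∷_ {n} c cs) = (c , 1 ∷ replicate n 0) ∷ map (λ (a , e) → (a , 0 ∷ e)) (affine c₀ cs)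

eval-affine : ∀ {n} c₀ (cs v : Vec ℕ n) → eval (affine c₀ cs) v ≡ c₀ + dot cs v
eval-affine c₀ []       [] = trans (+-identityʳ _) (trans (*-identityʳ c₀) (sym (+-identityʳ c₀)))
eval-affine c₀ (c ∷ cs) (x ∷ v) = trans (cong₂ _+_ leading rest) (+-CS.x∙yz≈y∙xz (c * x) c₀ _)
  where
  leading : c * (x * 1 * prodV (zipWith _^_ v (replicate _ 0))) ≡ c * x
  leading = cong (c *_) (trans (cong (x * 1 *_) (prodV-^-replicate-0 v)) (trans (*-identityʳ _) (*-identityʳ x)))
  rest : eval (map (λ (a , e) → (a , 0 ∷ e)) (affine c₀ cs)) (x ∷ v) ≡ c₀ + dot cs v
  rest = trans (∑-map _ (affine c₀ cs) (λ m → evalMonomial m (x ∷ v)))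
               (trans (∑-cong (affine c₀ cs) (λ (a , e) → cong (a *_) (*-identityˡ _))) (eval-affine c₀ cs v))

dot-*+ : ∀ {n} c (a u v : Vec ℕ n) →
         dot a (zipWith (λ uᵢ vᵢ → c * uᵢ + vᵢ) u v) ≡ c * dot a u + dot a v
dot-*+ c []       []       []       = sym (trans (+-identityʳ (c * 0)) (*-zeroʳ c))
dot-*+ c (a ∷ as) (u ∷ us) (v ∷ vs) = begin
  a * (c * u + v) + dot as (zipWith (λ uᵢ vᵢ → c * uᵢ + vᵢ) us vs)
    ≡⟨ cong (a * (c * u + v) +_) (dot-*+ c as us vs) ⟩
  a * (c * u + v) + (c * dot as us + dot as vs)
    ≡⟨ expand a c u v (dot as us) (dot as vs) ⟩
  c * (a * u + dot as us) + (a * v + dot as vs) ∎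
  where
  open ≡-Reasoning
  expand : ∀ a c u v U V → a * (c * u + v) + (c * U + V) ≡ c * (a * u + U) + (a * v + V)
  expand = solve-∀

deg-affine : ∀ {n} c₀ (cs : Vec ℕ n) → DegreeAtMost 1 (affine c₀ cs)
deg-affine c₀ []             = z≤n ∷ []
deg-affine c₀ (_∷_ {n} c cs) =
  ≤-reflexive (cong suc (totalDeg-replicate-0 n)) ∷ gmap⁺ (λ le → le) (deg-affine c₀ cs)

-- Binomial coefficients and power sums

[k+1]*[n+1]C[k+1]≡[n+1]*nCk : ∀ n k → suc k * (suc n C suc k) ≡ suc n * (n C k)
[k+1]*[n+1]C[k+1]≡[n+1]*nCk zero    zero    = refl
[k+1]*[n+1]C[k+1]≡[n+1]*nCk zero    (suc k) = begin
  suc (suc k) * (1 C suc (suc k)) ≡⟨ cong (suc (suc k) *_) (k>n⇒nCk≡0 {1} {suc (suc k)} (s≤s (s≤s z≤n))) ⟩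
  suc (suc k) * 0                 ≡⟨ *-zeroʳ (suc (suc k)) ⟩
  0                               ≡⟨ cong (1 *_) (k>n⇒nCk≡0 {0} {suc k} (s≤s z≤n)) ⟨
  1 * (0 C suc k)                 ∎
  where open ≡-Reasoning
[k+1]*[n+1]C[k+1]≡[n+1]*nCk (suc n) zero    =
  trans (*-identityˡ _) (trans (nC1≡n (suc (suc n))) (sym (*-identityʳ (suc (suc n)))))
[k+1]*[n+1]C[k+1]≡[n+1]*nCk (suc n) (suc k) = begin
  suc (suc k) * (suc (suc n) C suc (suc k))
    ≡⟨ cong (suc (suc k) *_) (nCk+nC[k+1]≡[n+1]C[k+1] (suc n) (suc k)) ⟨
  suc (suc k) * (a + b)
    ≡⟨ expand (suc k) a b ⟩
  a + (suc k * a + suc (suc k) * b)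
    ≡⟨ cong (a +_) (cong₂ _+_ ([k+1]*[n+1]C[k+1]≡[n+1]*nCk n k) ([k+1]*[n+1]C[k+1]≡[n+1]*nCk n (suc k))) ⟩
  a + (suc n * (n C k) + suc n * (n C suc k))
    ≡⟨ cong (a +_) (trans (sym (*-distribˡ-+ (suc n) (n C k) (n C suc k)))
                          (cong (suc n *_) (nCk+nC[k+1]≡[n+1]C[k+1] n k))) ⟩
  a + suc n * a ∎
  where
  open ≡-Reasoning
  a = suc n C suc k
  b = suc n C suc (suc k)
  expand : ∀ k a b → suc k * (a + b) ≡ a + (k * a + suc k * b)
  expand = solve-∀

[n+1]Cn≡n+1 : ∀ n → suc n C n ≡ suc n
[n+1]Cn≡n+1 n = trans (nCk≡nC[n∸k] (n≤1+n n)) (trans (cong (suc n C_) (m+n∸n≡m 1 n)) (nC1≡n (suc n)))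

binomial : ∀ n t N → n < N → suc t ^ n ≡ ∑[ k ∈ upTo N ] (n C k) * t ^ k
binomial zero t (suc N) _ = sym (begin
  ∑[ k ∈ upTo (suc N) ] (0 C k) * t ^ k
    ≡⟨ ∑-upTo-suc N (λ k → (0 C k) * t ^ k) ⟩
  1 + (∑[ k ∈ upTo N ] (0 C suc k) * t ^ suc k)
    ≡⟨ cong suc (∑-cong (upTo N) (λ k → cong (_* t ^ suc k) (k>n⇒nCk≡0 {0} {suc k} (s≤s z≤n)))) ⟩
  1 + (∑[ _ ∈ upTo N ] 0)
    ≡⟨ cong suc (∑-zero (upTo N)) ⟩
  1 ∎)
  where open ≡-Reasoning
binomial (suc n) t (suc N) (s≤s n<N) = begin
  suc t ^ n + t * suc t ^ n
    ≡⟨ cong₂ _+_ (binomial n t (suc N) (m<n⇒m<1+n n<N)) (cong (t *_) (binomial n t N n<N)) ⟩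
  (∑[ k ∈ upTo (suc N) ] (n C k) * t ^ k) + t * (∑[ k ∈ upTo N ] (n C k) * t ^ k)
    ≡⟨ cong₂ _+_ (∑-upTo-suc N (λ k → (n C k) * t ^ k))
                 (sym (∑-*ˡ (upTo N) t (λ k → (n C k) * t ^ k))) ⟩
  1 + (∑[ k ∈ upTo N ] (n C suc k) * t ^ suc k) + (∑[ k ∈ upTo N ] t * ((n C k) * t ^ k))
    ≡⟨ cong (λ x → 1 + (∑[ k ∈ upTo N ] (n C suc k) * t ^ suc k) + x)
            (∑-cong (upTo N) (λ k → *-CS.x∙yz≈y∙xz t (n C k) (t ^ k))) ⟩
  1 + (∑[ k ∈ upTo N ] (n C suc k) * t ^ suc k) + (∑[ k ∈ upTo N ] (n C k) * t ^ suc k)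
    ≡⟨ cong suc (+-comm (∑[ k ∈ upTo N ] (n C suc k) * t ^ suc k) _) ⟩
  1 + ((∑[ k ∈ upTo N ] (n C k) * t ^ suc k) + (∑[ k ∈ upTo N ] (n C suc k) * t ^ suc k))
    ≡⟨ cong suc (∑-+ (upTo N) (λ k → (n C k) * t ^ suc k) (λ k → (n C suc k) * t ^ suc k)) ⟨
  1 + (∑[ k ∈ upTo N ] (n C k) * t ^ suc k + (n C suc k) * t ^ suc k)
    ≡⟨ cong suc (∑-cong (upTo N) (λ k → trans (sym (*-distribʳ-+ (t ^ suc k) (n C k) _))
                                              (cong (_* t ^ suc k) (nCk+nC[k+1]≡[n+1]C[k+1] n k)))) ⟩
  1 + (∑[ k ∈ upTo N ] (suc n C suc k) * t ^ suc k)
    ≡⟨ ∑-upTo-suc N (λ k → (suc n C k) * t ^ k) ⟨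
  ∑[ k ∈ upTo (suc N) ] (suc n C k) * t ^ k ∎
  where open ≡-Reasoning

powerSum : ℕ → ℕ → ℕ
powerSum n e = ∑[ t ∈ upTo n ] t ^ e

powerSum-recurrence : ∀ n e → ∑[ k ∈ upTo (suc e) ] (suc e C k) * powerSum n k ≡ n ^ suc e
powerSum-recurrence n e = +-cancelʳ-≡ (powerSum n (suc e)) _ _ (begin
  (∑[ k ∈ upTo (suc e) ] (suc e C k) * powerSum n k) + powerSum n (suc e)
    ≡⟨ cong ((∑[ k ∈ upTo (suc e) ] (suc e C k) * powerSum n k) +_)
            (trans (sym (*-identityˡ _)) (cong (_* powerSum n (suc e)) (sym (nCn≡1 (suc e))))) ⟩
  (∑[ k ∈ upTo (suc e) ] (suc e C k) * powerSum n k) + (suc e C suc e) * powerSum n (suc e)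
    ≡⟨ ∑-upTo-sucʳ (suc e) (λ k → (suc e C k) * powerSum n k) ⟨
  ∑[ k ∈ upTo (suc (suc e)) ] (suc e C k) * powerSum n k
    ≡⟨ ∑-cong (upTo (suc (suc e))) (λ k → ∑-*ˡ (upTo n) (suc e C k) (_^ k)) ⟨
  ∑[ k ∈ upTo (suc (suc e)) ] ∑[ t ∈ upTo n ] (suc e C k) * t ^ k
    ≡⟨ ∑-swap (upTo n) (upTo (suc (suc e))) (λ t k → (suc e C k) * t ^ k) ⟨
  ∑[ t ∈ upTo n ] ∑[ k ∈ upTo (suc (suc e)) ] (suc e C k) * t ^ k
    ≡⟨ ∑-cong (upTo n) (λ t → binomial (suc e) t (suc (suc e)) ≤-refl) ⟨
  ∑[ t ∈ upTo n ] suc t ^ suc e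
    ≡⟨ ∑-upTo-suc n (_^ suc e) ⟨
  powerSum (suc n) (suc e)
    ≡⟨ ∑-upTo-sucʳ n (_^ suc e) ⟩
  powerSum n (suc e) + n ^ suc e
    ≡⟨ +-comm (powerSum n (suc e)) _ ⟩
  n ^ suc e + powerSum n (suc e) ∎)
  where open ≡-Reasoning

-- Congruences modulo p

0^n≡0 : ∀ n .{{_ : NonZero n}} → 0 ^ n ≡ 0
0^n≡0 (suc n) = refl

[m+o]∸[n+o]≡m∸n : ∀ m n o → m + o ∸ (n + o) ≡ m ∸ n
[m+o]∸[n+o]≡m∸n m n o = trans (cong₂ _∸_ (+-comm m o) (+-comm n o)) ([m+n]∸[m+o]≡n∸o o m n)

module Congruence (p : ℕ) .{{_ : NonZero p}} where

  -- A record rather than a definition, so that the implicit arguments of the lemmas below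
  -- stay inferable when p is a successor and _%_ unfolds.
  infix 4 _≈_
  record _≈_ (a b : ℕ) : Set where
    constructor mk≈
    field
      %-≡ : a % p ≡ b % p

  ≡⇒≈ : ∀ {a b} → a ≡ b → a ≈ b
  ≡⇒≈ a≡b = mk≈ (cong (_% p) a≡b)

  ≈-refl : ∀ {a} → a ≈ a
  ≈-refl = mk≈ refl

  ≈-sym : ∀ {a b} → a ≈ b → b ≈ a
  ≈-sym (mk≈ e) = mk≈ (sym e)

  ≈-trans : ∀ {a b c} → a ≈ b → b ≈ c → a ≈ c
  ≈-trans (mk≈ e) (mk≈ e′) = mk≈ (trans e e′)

  ≈-setoid : Setoid 0ℓ 0ℓ
  ≈-setoid = record { _≈_ = _≈_ ; isEquivalence = record { refl = ≈-refl ; sym = ≈-sym ; trans = ≈-trans } }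

  module ≈-Reasoning = SetoidReasoning ≈-setoid

  ≈-+ : ∀ {a a′ b b′} → a ≈ a′ → b ≈ b′ → a + b ≈ a′ + b′
  ≈-+ {a} {a′} {b} {b′} (mk≈ a≈a′) (mk≈ b≈b′) =
    mk≈ (trans (%-distribˡ-+ a b p)
        (trans (cong₂ (λ x y → (x + y) % p) a≈a′ b≈b′) (sym (%-distribˡ-+ a′ b′ p))))

  ≈-* : ∀ {a a′ b b′} → a ≈ a′ → b ≈ b′ → a * b ≈ a′ * b′
  ≈-* {a} {a′} {b} {b′} (mk≈ a≈a′) (mk≈ b≈b′) =
    mk≈ (trans (%-distribˡ-* a b p)
        (trans (cong₂ (λ x y → (x * y) % p) a≈a′ b≈b′) (sym (%-distribˡ-* a′ b′ p))))

  ≈-^ : ∀ {a a′} → a ≈ a′ → ∀ k → a ^ k ≈ a′ ^ k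
  ≈-^ a≈a′ zero    = ≈-refl
  ≈-^ a≈a′ (suc k) = ≈-* a≈a′ (≈-^ a≈a′ k)

  %-≈ : ∀ a → a % p ≈ a
  %-≈ a = mk≈ (m%n%n≡m%n a p)

  ∣⇒≈0 : ∀ {a} → p ∣ a → a ≈ 0
  ∣⇒≈0 {a} p∣a = mk≈ (trans (n∣m⇒m%n≡0 a p p∣a) (sym (m*n%n≡0 0 p)))

  ≈0⇒∣ : ∀ {a} → a ≈ 0 → p ∣ a
  ≈0⇒∣ {a} (mk≈ a≈0) = m%n≡0⇒n∣m a p (trans a≈0 (m*n%n≡0 0 p))

  ≈⇒∣∸ : ∀ {a b} → a ≈ b → b ≤ a → p ∣ a ∸ b
  ≈⇒∣∸ {a} {b} (mk≈ a≈b) b≤a = divides (a / p ∸ b / p) (begin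
    a ∸ b                                   ≡⟨ cong₂ _∸_ (m≡m%n+[m/n]*n a p) (m≡m%n+[m/n]*n b p) ⟩
    a % p + a / p * p ∸ (b % p + b / p * p) ≡⟨ cong (λ r → a % p + a / p * p ∸ (r + b / p * p)) a≈b ⟨
    a % p + a / p * p ∸ (a % p + b / p * p) ≡⟨ [m+n]∸[m+o]≡n∸o (a % p) _ _ ⟩
    a / p * p ∸ b / p * p                   ≡⟨ *-distribʳ-∸ p (a / p) (b / p) ⟨
    (a / p ∸ b / p) * p                     ∎)
    where open ≡-Reasoning

  ∣∸⇒≈ : ∀ {a b} → b ≤ a → p ∣ a ∸ b → a ≈ b
  ∣∸⇒≈ {a} {b} b≤a p∣a∸b = mk≈ (trans (cong (_% p) (sym (m∸n+n≡m b≤a))) (%-remove-+ˡ b p∣a∸b))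

  +-cancelʳ-≈ : ∀ {a b} c → a + c ≈ b + c → a ≈ b
  +-cancelʳ-≈ {a} {b} c a+c≈b+c with ≤-total b a
  ... | inj₁ b≤a =
    ∣∸⇒≈ b≤a (subst (p ∣_) ([m+o]∸[n+o]≡m∸n a b c) (≈⇒∣∸ a+c≈b+c (+-monoˡ-≤ c b≤a)))
  ... | inj₂ a≤b =
    ≈-sym (∣∸⇒≈ a≤b (subst (p ∣_) ([m+o]∸[n+o]≡m∸n b a c) (≈⇒∣∸ (≈-sym a+c≈b+c) (+-monoˡ-≤ c a≤b))))

  ∑-≈ : {A : Set} (xs : List A) {f g : A → ℕ} → (∀ x → f x ≈ g x) → ∑ xs f ≈ ∑ xs g
  ∑-≈ []       f≈g = ≈-refl
  ∑-≈ (x ∷ xs) f≈g = ≈-+ (f≈g x) (∑-≈ xs f≈g)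

  eval-≈ : ∀ {n} (P : Poly n) {v w : Vec ℕ n} → Pointwise _≈_ v w → eval P v ≈ eval P w
  eval-≈ P v≈w = ∑-≈ P (λ (a , e) → ≈-* {a} ≈-refl (prodV-≈ e v≈w))
    where
    prodV-≈ : ∀ {m} (e : Vec ℕ m) {v w : Vec ℕ m} → Pointwise _≈_ v w →
              prodV (zipWith _^_ v e) ≈ prodV (zipWith _^_ w e)
    prodV-≈ []       []          = ≈-refl
    prodV-≈ (k ∷ e) (x≈y ∷ v≈w) = ≈-* (≈-^ x≈y k) (prodV-≈ e v≈w)

module PrimeField (q : ℕ) (p-prime : Prime (suc q)) where

  p : ℕ
  p = suc q

  open Congruence p public

  instance
    q-nonZero : NonZero q
    q-nonZero = ≢-nonZero (λ q≡0 → ¬prime[1] (subst (Prime ∘ suc) q≡0 p-prime))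

  -- Fermat's little theorem and power sums

  0<k<p⇒p∤k : ∀ {k} → 0 < k → k < p → ¬ p ∣ k
  0<k<p⇒p∤k {suc k} _ k<p p∣k = <⇒≱ k<p (∣⇒≤ p∣k)

  ∤m⇒∣m*n⇒∣n : ∀ {u a} → ¬ p ∣ u → p ∣ u * a → p ∣ a
  ∤m⇒∣m*n⇒∣n {u} {a} p∤u p∣ua with euclidsLemma u a p-prime p∣ua
  ... | inj₁ p∣u = contradiction p∣u p∤u
  ... | inj₂ p∣a = p∣a

  p∣pCk : ∀ {k} → 0 < k → k < p → p ∣ p C k
  p∣pCk {suc k} 0<k k<p = ∤m⇒∣m*n⇒∣n (0<k<p⇒p∤k 0<k k<p)
    (subst (p ∣_) (sym ([k+1]*[n+1]C[k+1]≡[n+1]*nCk q k)) (m∣m*n (q C k)))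

  private
    *-cancelˡ-≈-≤ : ∀ {u a b} → ¬ p ∣ u → u * a ≈ u * b → b ≤ a → a ≈ b
    *-cancelˡ-≈-≤ {u} {a} {b} p∤u ua≈ub b≤a =
      ∣∸⇒≈ b≤a (∤m⇒∣m*n⇒∣n p∤u
        (subst (p ∣_) (sym (*-distribˡ-∸ u a b)) (≈⇒∣∸ ua≈ub (*-monoʳ-≤ u b≤a))))

  *-cancelˡ-≈ : ∀ {u a b} → ¬ p ∣ u → u * a ≈ u * b → a ≈ b
  *-cancelˡ-≈ {u} {a} {b} p∤u ua≈ub with ≤-total b a
  ... | inj₁ b≤a = *-cancelˡ-≈-≤ p∤u ua≈ub b≤a
  ... | inj₂ a≤b = ≈-sym (*-cancelˡ-≈-≤ p∤u (≈-sym ua≈ub) a≤b)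

  fermat : ∀ a → a ^ p ≈ a
  fermat zero    = ≈-refl
  fermat (suc a) = begin
    suc a ^ p
      ≡⟨ binomial p a (suc p) ≤-refl ⟩
    ∑[ k ∈ upTo (suc p) ] (p C k) * a ^ k
      ≡⟨ ∑-upTo-suc p (λ k → (p C k) * a ^ k) ⟩
    1 + (∑[ k ∈ upTo p ] (p C suc k) * a ^ suc k)
      ≡⟨ cong suc (∑-upTo-sucʳ q (λ k → (p C suc k) * a ^ suc k)) ⟩
    1 + ((∑[ k ∈ upTo q ] (p C suc k) * a ^ suc k) + (p C p) * a ^ p)
      ≈⟨ ≈-+ {1} ≈-refl (≈-+ inner-terms last-term) ⟩
    1 + (0 + 1 * a)
      ≡⟨ cong suc (*-identityˡ a) ⟩
    suc a ∎
    where
    open ≈-Reasoning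
    inner-terms : (∑[ k ∈ upTo q ] (p C suc k) * a ^ suc k) ≈ 0
    inner-terms = ∣⇒≈0 (∑-∣ (upTo q) _ (applyUpTo⁺₁ (λ k → k) q
      (λ {k} k<q → ∣m⇒∣m*n (a ^ suc k) (p∣pCk (s≤s z≤n) (s≤s k<q)))))
    last-term : (p C p) * a ^ p ≈ 1 * a
    last-term = ≈-* (≡⇒≈ (nCn≡1 p)) (fermat a)

  fermat′ : ∀ {a} → ¬ p ∣ a → a ^ q ≈ 1
  fermat′ {a} p∤a = *-cancelˡ-≈ p∤a (≈-trans (fermat a) (≡⇒≈ (sym (*-identityʳ a))))

  p∣powerSum : ∀ e → e < q → p ∣ powerSum p e
  p∣powerSum = <-rec (λ e → e < q → p ∣ powerSum p e) step
    where
    step : ∀ e → (∀ {k} → k < e → k < q → p ∣ powerSum p k) → e < q → p ∣ powerSum p e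
    step e rec e<q = ∤m⇒∣m*n⇒∣n (0<k<p⇒p∤k (s≤s z≤n) (s≤s e<q))
      (∣m+n∣m⇒∣n (subst (p ∣_) (sym recurrence) (m∣m*n (p ^ e))) lower-terms)
      where
      recurrence : (∑[ k ∈ upTo e ] (suc e C k) * powerSum p k) + suc e * powerSum p e ≡ p ^ suc e
      recurrence = begin
        (∑[ k ∈ upTo e ] (suc e C k) * powerSum p k) + suc e * powerSum p e
          ≡⟨ cong ((∑[ k ∈ upTo e ] (suc e C k) * powerSum p k) +_) (cong (_* powerSum p e) ([n+1]Cn≡n+1 e)) ⟨
        (∑[ k ∈ upTo e ] (suc e C k) * powerSum p k) + (suc e C e) * powerSum p e
          ≡⟨ ∑-upTo-sucʳ e (λ k → (suc e C k) * powerSum p k) ⟨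
        ∑[ k ∈ upTo (suc e) ] (suc e C k) * powerSum p k
          ≡⟨ powerSum-recurrence p e ⟩
        p ^ suc e ∎
        where open ≡-Reasoning
      lower-terms : p ∣ ∑[ k ∈ upTo e ] (suc e C k) * powerSum p k
      lower-terms = ∑-∣ (upTo e) _ (applyUpTo⁺₁ (λ k → k) e
        (λ {k} k<e → ∣n⇒∣m*n (suc e C k) (rec k<e (<-trans k<e e<q))))

  -- The Chevalley–Warning theorem

  ∑-allPoints-monomial : ∀ {m} (e : Vec ℕ m) →
    ∑[ x ∈ allPoints p m ] prodV (zipWith _^_ (toℕs x) e) ≡ prodV (Vec.map (powerSum p) e)
  ∑-allPoints-monomial []            = refl
  ∑-allPoints-monomial {suc m} (e₀ ∷ e) = begin
    ∑[ x ∈ allPoints p (suc m) ] prodV (zipWith _^_ (toℕs x) (e₀ ∷ e))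
      ≡⟨ ∑-allPoints-suc m _ ⟩
    ∑[ i ∈ allFin p ] ∑[ x ∈ allPoints p m ] toℕ i ^ e₀ * prodV (zipWith _^_ (toℕs x) e)
      ≡⟨ ∑-cong (allFin p) (λ i → ∑-*ˡ (allPoints p m) (toℕ i ^ e₀) _) ⟩
    ∑[ i ∈ allFin p ] toℕ i ^ e₀ * (∑[ x ∈ allPoints p m ] prodV (zipWith _^_ (toℕs x) e))
      ≡⟨ ∑-*ʳ (allFin p) _ (λ i → toℕ i ^ e₀) ⟩
    (∑[ i ∈ allFin p ] toℕ i ^ e₀) * (∑[ x ∈ allPoints p m ] prodV (zipWith _^_ (toℕs x) e))
      ≡⟨ cong₂ _*_ (∑-allFin-toℕ p (_^ e₀)) (∑-allPoints-monomial e) ⟩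
    powerSum p e₀ * prodV (Vec.map (powerSum p) e) ∎
    where open ≡-Reasoning

  p∣prodV-powerSum : ∀ {m} (e : Vec ℕ m) → totalDeg e < m * q → p ∣ prodV (Vec.map (powerSum p) e)
  p∣prodV-powerSum {suc m} (e₀ ∷ e) deg< with e₀ <? q
  ... | yes e₀<q = ∣m⇒∣m*n _ (p∣powerSum e₀ e₀<q)
  ... | no  e₀≮q = ∣n⇒∣m*n (powerSum p e₀) (p∣prodV-powerSum e (+-cancelˡ-< q (totalDeg e) (m * q)
                     (≤-<-trans (+-monoˡ-≤ (totalDeg e) (≮⇒≥ e₀≮q)) deg<)))

  p∣∑-monomial : ∀ {m} a (e : Vec ℕ m) → totalDeg e < m * q →
    p ∣ ∑[ x ∈ allPoints p m ] evalMonomial (a , e) (toℕs x)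
  p∣∑-monomial {m} a e deg< = subst (p ∣_) (sym sum-factorises) (∣n⇒∣m*n a (p∣prodV-powerSum e deg<))
    where
    sum-factorises : ∑[ x ∈ allPoints p m ] evalMonomial (a , e) (toℕs x) ≡ a * prodV (Vec.map (powerSum p) e)
    sum-factorises = trans (∑-*ˡ (allPoints p m) a _) (cong (a *_) (∑-allPoints-monomial e))

  p∣∑-eval : ∀ {m d} (P : Poly m) → DegreeAtMost d P → d < m * q → p ∣ ∑[ x ∈ allPoints p m ] eval P (toℕs x)
  p∣∑-eval {m} P degP d<mq =
    subst (p ∣_) (∑-swap P (allPoints p m) (λ mono x → evalMonomial mono (toℕs x)))
      (∑-∣ P _ (All.map (λ {(a , e)} deg≤d → p∣∑-monomial a e (≤-<-trans deg≤d d<mq)) degP))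

  -- 1 − Q^(p−1), with −1 written as q; by Fermat it is 𝟙[p ∣ Q] modulo p.
  zeroIndicator : ∀ {m} → Poly m → Poly m
  zeroIndicator Q = constᴾ 1 ++ q ·ᴾ Q ^ᴾ q

  commonZeroIndicator : ∀ {m c} → (Fin c → Poly m) → Poly m
  commonZeroIndicator {c = zero}  Qs = constᴾ 1
  commonZeroIndicator {c = suc c} Qs = zeroIndicator (Qs zero) *ᴾ commonZeroIndicator (Qs ∘ suc)

  eval-zeroIndicator-≡ : ∀ {m} (Q : Poly m) v → eval (zeroIndicator Q) v ≡ 1 + q * eval Q v ^ q
  eval-zeroIndicator-≡ Q v = begin
    eval (constᴾ 1 ++ q ·ᴾ Q ^ᴾ q) v            ≡⟨ eval-++ (constᴾ 1) (q ·ᴾ Q ^ᴾ q) v ⟩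
    eval (constᴾ 1) v + eval (q ·ᴾ Q ^ᴾ q) v    ≡⟨ cong₂ _+_ (eval-constᴾ 1 v) (eval-·ᴾ q (Q ^ᴾ q) v) ⟩
    1 + q * eval (Q ^ᴾ q) v                     ≡⟨ cong (λ z → 1 + q * z) (eval-^ᴾ Q q v) ⟩
    1 + q * eval Q v ^ q                        ∎
    where open ≡-Reasoning

  eval-zeroIndicator : ∀ {m} (Q : Poly m) (x : Vec (Fin p) m) →
    eval (zeroIndicator Q) (toℕs x) ≈ 𝟙 (isZeroᵇ {p} Q x)
  eval-zeroIndicator Q x with p ∣? evalℕ Q x
  ... | yes p∣Qx = begin
    eval (zeroIndicator Q) v   ≡⟨ eval-zeroIndicator-≡ Q v ⟩
    1 + q * eval Q v ^ q       ≈⟨ ≈-+ {1} ≈-refl (≈-* {q} ≈-refl (≈-^ (∣⇒≈0 p∣Qv) q)) ⟩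
    1 + q * 0 ^ q              ≡⟨ cong (λ z → 1 + q * z) (0^n≡0 q) ⟩
    1 + q * 0                  ≡⟨ cong suc (*-zeroʳ q) ⟩
    1                          ∎
    where
    open ≈-Reasoning
    v = toℕs x
    p∣Qv : p ∣ eval Q v
    p∣Qv = subst (p ∣_) (evalℕ≡eval Q x) p∣Qx
  ... | no p∤Qx = begin
    eval (zeroIndicator Q) v   ≡⟨ eval-zeroIndicator-≡ Q v ⟩
    1 + q * eval Q v ^ q       ≈⟨ ≈-+ {1} ≈-refl (≈-* {q} ≈-refl (fermat′ p∤Qv)) ⟩
    1 + q * 1                  ≡⟨ cong suc (*-identityʳ q) ⟩
    p                          ≈⟨ ∣⇒≈0 (∣-refl {p}) ⟩
    0                          ∎
    where
    open ≈-Reasoning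
    v = toℕs x
    p∤Qv : ¬ p ∣ eval Q v
    p∤Qv = p∤Qx ∘ subst (p ∣_) (sym (evalℕ≡eval Q x))

  eval-commonZeroIndicator : ∀ {m c} (Qs : Fin c → Poly m) (x : Vec (Fin p) m) →
    eval (commonZeroIndicator Qs) (toℕs x) ≈ 𝟙 (isCommonZeroᵇ {p} Qs x)
  eval-commonZeroIndicator {c = zero}  Qs x = ≡⇒≈ (eval-constᴾ 1 (toℕs x))
  eval-commonZeroIndicator {c = suc c} Qs x = begin
    eval (zeroIndicator (Qs zero) *ᴾ commonZeroIndicator (Qs ∘ suc)) v
      ≡⟨ eval-*ᴾ (zeroIndicator (Qs zero)) (commonZeroIndicator (Qs ∘ suc)) v ⟩
    eval (zeroIndicator (Qs zero)) v * eval (commonZeroIndicator (Qs ∘ suc)) v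
      ≈⟨ ≈-* (eval-zeroIndicator (Qs zero) x) (eval-commonZeroIndicator (Qs ∘ suc) x) ⟩
    𝟙 (isZeroᵇ {p} (Qs zero) x) * 𝟙 (isCommonZeroᵇ {p} (Qs ∘ suc) x)
      ≡⟨ 𝟙-∧ (isZeroᵇ {p} (Qs zero) x) _ ⟨
    𝟙 (isCommonZeroᵇ {p} Qs x) ∎
    where
    open ≈-Reasoning
    v = toℕs x

  deg-commonZeroIndicator : ∀ {m c d} (Qs : Fin c → Poly m) → (∀ j → DegreeAtMost d (Qs j)) →
    DegreeAtMost (c * (q * d)) (commonZeroIndicator Qs)
  deg-commonZeroIndicator {c = zero}  Qs degQs = deg-constᴾ 1
  deg-commonZeroIndicator {c = suc c} Qs degQs =
    deg-*ᴾ (++⁺ (deg-mono z≤n (deg-constᴾ 1)) (deg-·ᴾ q (deg-^ᴾ (degQs zero) q)))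
           (deg-commonZeroIndicator (Qs ∘ suc) (degQs ∘ suc))

  chevalley-warning : ∀ {m c d} (Qs : Fin c → Poly m) → (∀ j → DegreeAtMost d (Qs j)) → c * d < m →
    p ∣ numCommonZeros p m c Qs
  chevalley-warning {m} {c} {d} Qs degQs cd<m = ≈0⇒∣ (begin
    numCommonZeros p m c Qs
      ≡⟨ countTrue≡∑𝟙 (isCommonZeroᵇ {p} Qs) (allPoints p m) ⟩
    ∑[ x ∈ allPoints p m ] 𝟙 (isCommonZeroᵇ {p} Qs x)
      ≈⟨ ∑-≈ (allPoints p m) (λ x → eval-commonZeroIndicator Qs x) ⟨
    ∑[ x ∈ allPoints p m ] eval (commonZeroIndicator Qs) (toℕs x)
      ≈⟨ ∣⇒≈0 (p∣∑-eval (commonZeroIndicator Qs) (deg-commonZeroIndicator Qs degQs) degree<) ⟩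
    0 ∎)
    where
    open ≈-Reasoning
    degree< : c * (q * d) < m * q
    degree< = subst₂ _<_ (*-CS.x∙yz≈y∙xz q c d) (*-comm q m) (*-monoʳ-< q cd<m)

  -- Restriction to graphs, and solutions of affine equations

  toℕ-mod-≈ : ∀ a → toℕ (a mod p) ≈ a
  toℕ-mod-≈ a = ≈-trans (≡⇒≈ (toℕ-fromℕ< (m%n<n a p))) (%-≈ a)

  mod-≡⇒≈ : ∀ {a b} → a mod p ≡ b mod p → a ≈ b
  mod-≡⇒≈ {a} {b} a≡b = ≈-trans (≈-sym (toℕ-mod-≈ a)) (≈-trans (≡⇒≈ (cong toℕ a≡b)) (toℕ-mod-≈ b))

  ⌊p∣?⌋-≈ : ∀ {a b} → a ≈ b → ⌊ p ∣? a ⌋ ≡ ⌊ p ∣? b ⌋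
  ⌊p∣?⌋-≈ {a} {b} a≈b with p ∣? a | p ∣? b
  ... | yes _   | yes _   = refl
  ... | no  _   | no  _   = refl
  ... | yes p∣a | no  p∤b = contradiction (≈0⇒∣ (≈-trans (≈-sym a≈b) (∣⇒≈0 p∣a))) p∤b
  ... | no  p∤a | yes p∣b = contradiction (≈0⇒∣ (≈-trans a≈b (∣⇒≈0 p∣b))) p∤a

  onGraph : ∀ {k} → Poly k → Vec (Fin p) (suc k) → Bool
  onGraph L (y₀ ∷ y) = does (y₀ ≟ eval L (toℕs y) mod p)

  isCommonZeroᵇ-substFirst : ∀ {k c} (L : Poly k) (Qs : Fin c → Poly (suc k)) (y : Vec (Fin p) k) →
    isCommonZeroᵇ {p} (substFirst L ∘ Qs) y ≡ isCommonZeroᵇ {p} Qs (eval L (toℕs y) mod p ∷ y)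
  isCommonZeroᵇ-substFirst L Qs y = allᵇ-cong (λ j → ⌊p∣?⌋-≈ (begin
    evalℕ (substFirst L (Qs j)) y
      ≡⟨ evalℕ≡eval (substFirst L (Qs j)) y ⟩
    eval (substFirst L (Qs j)) v
      ≡⟨ eval-substFirst L (Qs j) v ⟩
    eval (Qs j) (eval L v ∷ v)
      ≈⟨ eval-≈ (Qs j) (≈-sym (toℕ-mod-≈ (eval L v)) ∷ Pointwise.refl ≈-refl) ⟩
    eval (Qs j) (toℕ (eval L v mod p) ∷ v)
      ≡⟨ evalℕ≡eval (Qs j) (eval L v mod p ∷ y) ⟨
    evalℕ (Qs j) (eval L v mod p ∷ y) ∎))
    where
    open ≈-Reasoning
    v = toℕs y

  numCommonZeros-substFirst : ∀ {k c} (L : Poly k) (Qs : Fin c → Poly (suc k)) →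
    numCommonZeros p k c (substFirst L ∘ Qs) ≡
    ∑[ y ∈ allPoints p (suc k) ] 𝟙 (onGraph L y) * 𝟙 (isCommonZeroᵇ {p} Qs y)
  numCommonZeros-substFirst {k} {c} L Qs = begin
    numCommonZeros p k c (substFirst L ∘ Qs)
      ≡⟨ countTrue≡∑𝟙 (isCommonZeroᵇ {p} (substFirst L ∘ Qs)) (allPoints p k) ⟩
    ∑[ y ∈ allPoints p k ] 𝟙 (isCommonZeroᵇ {p} (substFirst L ∘ Qs) y)
      ≡⟨ ∑-cong (allPoints p k) (λ y → cong 𝟙 (isCommonZeroᵇ-substFirst L Qs y)) ⟩
    ∑[ y ∈ allPoints p k ] g (ℓ y ∷ y)
      ≡⟨ ∑-cong (allPoints p k) (λ y → ∑-allFin-δ (ℓ y) (λ i → g (i ∷ y))) ⟨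
    ∑[ y ∈ allPoints p k ] ∑[ i ∈ allFin p ] 𝟙 (does (i ≟ ℓ y)) * g (i ∷ y)
      ≡⟨ ∑-swap (allPoints p k) (allFin p) (λ y i → 𝟙 (does (i ≟ ℓ y)) * g (i ∷ y)) ⟩
    ∑[ i ∈ allFin p ] ∑[ y ∈ allPoints p k ] 𝟙 (does (i ≟ ℓ y)) * g (i ∷ y)
      ≡⟨ ∑-allPoints-suc k (λ y → 𝟙 (onGraph L y) * g y) ⟨
    ∑[ y ∈ allPoints p (suc k) ] 𝟙 (onGraph L y) * g y ∎
    where
    open ≡-Reasoning
    ℓ : Vec (Fin p) k → Fin p
    ℓ y = eval L (toℕs y) mod p
    g : Vec (Fin p) (suc k) → ℕ
    g y = 𝟙 (isCommonZeroᵇ {p} Qs y)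

  toℕ-≈⇒≡ : ∀ {x y : Fin p} → toℕ x ≈ toℕ y → x ≡ y
  toℕ-≈⇒≡ {x} {y} (mk≈ x≈y) =
    toℕ-injective (trans (sym (m<n⇒m%n≡m (toℕ<n x))) (trans x≈y (m<n⇒m%n≡m (toℕ<n y))))

  affine-mod-injective : ∀ {w c} {x y : Fin p} → ¬ p ∣ w →
    (toℕ x * w + c) mod p ≡ (toℕ y * w + c) mod p → x ≡ y
  affine-mod-injective {w} {c} {x} {y} p∤w xw+c≡yw+c = toℕ-≈⇒≡ (*-cancelˡ-≈ p∤w (begin
    w * toℕ x     ≡⟨ *-comm w (toℕ x) ⟩
    toℕ x * w     ≈⟨ +-cancelʳ-≈ c (mod-≡⇒≈ xw+c≡yw+c) ⟩
    toℕ y * w     ≡⟨ *-comm (toℕ y) w ⟩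
    w * toℕ y     ∎))
    where open ≈-Reasoning

  affine-count : ∀ {j} (t : Fin p) (s : ℕ) (w : Vec ℕ (suc j)) → Any (λ wᵢ → ¬ p ∣ wᵢ) w →
    ∑[ a ∈ allPoints p (suc j) ] 𝟙 (does (t ≟ (s + dot (toℕs a) w) mod p)) ≤ p ^ j
  affine-count {j} t s (w₀ ∷ w) (here p∤w₀) = begin
    ∑[ a ∈ allPoints p (suc j) ] 𝟙 (does (t ≟ (s + dot (toℕs a) (w₀ ∷ w)) mod p))
      ≡⟨ ∑-allPoints-suc j _ ⟩
    ∑[ a₀ ∈ allFin p ] ∑[ a ∈ allPoints p j ] solves a₀ a
      ≡⟨ ∑-swap (allFin p) (allPoints p j) solves ⟩
    ∑[ a ∈ allPoints p j ] ∑[ a₀ ∈ allFin p ] solves a₀ a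
      ≤⟨ ∑-mono-≤ (allPoints p j) (λ a → ∑-allFin-𝟙≤1 p _ (unique-solution a)) ⟩
    ∑[ _ ∈ allPoints p j ] 1
      ≡⟨ trans (∑-allPoints-const j 1) (*-identityʳ (p ^ j)) ⟩
    p ^ j ∎
    where
    open ≤-Reasoning
    lhs : Fin p → Vec (Fin p) j → ℕ
    lhs a₀ a = s + (toℕ a₀ * w₀ + dot (toℕs a) w)
    solves : Fin p → Vec (Fin p) j → ℕ
    solves a₀ a = 𝟙 (does (t ≟ lhs a₀ a mod p))
    unique-solution : ∀ a a₀ b₀ →
      does (t ≟ lhs a₀ a mod p) ≡ true → does (t ≟ lhs b₀ a mod p) ≡ true → a₀ ≡ b₀
    unique-solution a a₀ b₀ t≡a₀ t≡b₀ = affine-mod-injective p∤w₀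
      (trans (cong (_mod p) (sym (rearrange a₀)))
      (trans (sym (≟-true⇒≡ t _ t≡a₀))
      (trans (≟-true⇒≡ t _ t≡b₀) (cong (_mod p) (rearrange b₀)))))
      where
      D = dot (toℕs a) w
      rearrange : ∀ x → lhs x a ≡ toℕ x * w₀ + (s + D)
      rearrange x = +-CS.x∙yz≈y∙xz s (toℕ x * w₀) D
  affine-count {zero}  t s (w₀ ∷ []) (there ())
  affine-count {suc j} t s (w₀ ∷ w) (there p∤wᵢ) = begin
    ∑[ a ∈ allPoints p (suc (suc j)) ] 𝟙 (does (t ≟ (s + dot (toℕs a) (w₀ ∷ w)) mod p))
      ≡⟨ ∑-allPoints-suc (suc j) _ ⟩
    ∑[ a₀ ∈ allFin p ] ∑[ a ∈ allPoints p (suc j) ] 𝟙 (does (t ≟ (s + (toℕ a₀ * w₀ + dot (toℕs a) w)) mod p))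
      ≡⟨ ∑-cong (allFin p) (λ a₀ → ∑-cong (allPoints p (suc j)) (λ a →
           cong (λ x → 𝟙 (does (t ≟ x mod p))) (sym (+-assoc s _ _)))) ⟩
    ∑[ a₀ ∈ allFin p ] ∑[ a ∈ allPoints p (suc j) ] 𝟙 (does (t ≟ (s + toℕ a₀ * w₀ + dot (toℕs a) w) mod p))
      ≤⟨ ∑-mono-≤ (allFin p) (λ a₀ → affine-count t (s + toℕ a₀ * w₀) w p∤wᵢ) ⟩
    ∑[ _ ∈ allFin p ] p ^ j
      ≡⟨ ∑-allFin-const p (p ^ j) ⟩
    p ^ suc j ∎
    where open ≤-Reasoning

  ≢⇒p∤q*z+y : ∀ {y z : Fin p} → y ≢ z → ¬ p ∣ q * toℕ z + toℕ y
  ≢⇒p∤q*z+y {y} {z} y≢z p∣qz+y = y≢z (toℕ-≈⇒≡ (begin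
    toℕ y                        ≈⟨ mk≈ (%-remove-+ʳ (toℕ y) (m∣m*n (toℕ z))) ⟨
    toℕ y + p * toℕ z            ≡⟨ +-comm (toℕ y) (p * toℕ z) ⟩
    toℕ z + q * toℕ z + toℕ y    ≡⟨ cong (_+ toℕ y) (+-comm (toℕ z) (q * toℕ z)) ⟩
    q * toℕ z + toℕ z + toℕ y    ≡⟨ +-CS.xy∙z≈xz∙y (q * toℕ z) (toℕ z) (toℕ y) ⟩
    q * toℕ z + toℕ y + toℕ z    ≈⟨ ≈-+ (∣⇒≈0 p∣qz+y) (≈-refl {toℕ z}) ⟩
    toℕ z                        ∎))
    where open ≈-Reasoning

  ≢⇒Any-p∤ : ∀ {k} (y z : Vec (Fin p) k) → y ≢ z →
    Any (λ w → ¬ p ∣ w) (zipWith (λ zᵢ yᵢ → q * zᵢ + yᵢ) (toℕs z) (toℕs y))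
  ≢⇒Any-p∤ []       []       []≢[] = contradiction refl []≢[]
  ≢⇒Any-p∤ (y₀ ∷ y) (z₀ ∷ z) y≢z with y₀ ≟ z₀
  ... | yes refl  = there (≢⇒Any-p∤ y z (y≢z ∘ cong (y₀ ∷_)))
  ... | no  y₀≢z₀ = here (≢⇒p∤q*z+y y₀≢z₀)

  module Hyperplanes {j : ℕ} (z₀ : Fin p) (z : Vec (Fin p) (suc j)) where

    -- The hyperplane x₀ = z₀ + a·(y − z) of slope a, with −1 written as q;
    -- direction y stands for y − z.
    hyperplane : Vec (Fin p) (suc j) → Poly (suc j)
    hyperplane a = affine (toℕ z₀ + q * dot (toℕs a) (toℕs z)) (toℕs a)

    direction : Vec (Fin p) (suc j) → Vec ℕ (suc j)
    direction y = zipWith (λ zᵢ yᵢ → q * zᵢ + yᵢ) (toℕs z) (toℕs y)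

    eval-hyperplane : ∀ a y → eval (hyperplane a) (toℕs y) ≡ toℕ z₀ + dot (toℕs a) (direction y)
    eval-hyperplane a y = begin
      eval (hyperplane a) y°                ≡⟨ eval-affine _ a° y° ⟩
      toℕ z₀ + q * dot a° z° + dot a° y°    ≡⟨ +-assoc (toℕ z₀) _ _ ⟩
      toℕ z₀ + (q * dot a° z° + dot a° y°)  ≡⟨ cong (toℕ z₀ +_) (dot-*+ q a° z° y°) ⟨
      toℕ z₀ + dot a° (direction y)         ∎
      where
      open ≡-Reasoning
      a° = toℕs a
      y° = toℕs y
      z° = toℕs z

    hyperplane-through : ∀ a → eval (hyperplane a) (toℕs z) mod p ≡ z₀
    hyperplane-through a = toℕ-injective (begin
      toℕ (eval (hyperplane a) z° mod p)         ≡⟨ toℕ-fromℕ< (m%n<n (eval (hyperplane a) z°) p) ⟩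
      eval (hyperplane a) z° % p                 ≡⟨ cong (_% p) (eval-hyperplane a z) ⟩
      (toℕ z₀ + dot a° (direction z)) % p        ≡⟨ cong (λ x → (toℕ z₀ + x) % p) (dot-*+ q a° z° z°) ⟩
      (toℕ z₀ + (q * dot a° z° + dot a° z°)) % p ≡⟨ %-remove-+ʳ (toℕ z₀) p∣q*D+D ⟩
      toℕ z₀ % p                                 ≡⟨ m<n⇒m%n≡m (toℕ<n z₀) ⟩
      toℕ z₀                                     ∎)
      where
      open ≡-Reasoning
      a° = toℕs a
      z° = toℕs z
      p∣q*D+D : p ∣ q * dot a° z° + dot a° z°
      p∣q*D+D = subst (p ∣_) (+-comm (dot a° z°) _) (m∣m*n (dot a° z°))

    graphCount : Vec (Fin p) (suc (suc j)) → ℕ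
    graphCount y = ∑[ a ∈ allPoints p (suc j) ] 𝟙 (onGraph (hyperplane a) y)

    graphCount-≤ : ∀ y → graphCount y ≤ p ^ j + 𝟙 (does (y ≟ᵥ (z₀ ∷ z))) * (q * p ^ j)
    graphCount-≤ (y₀ ∷ y) with y ≟ᵥ z
    ... | no y≢z = ≤-trans (≤-reflexive (∑-cong (allPoints p (suc j)) on-affine-equation))
                           (≤-trans (affine-count y₀ (toℕ z₀) (direction y) (≢⇒Any-p∤ y z y≢z)) (m≤m+n _ _))
      where
      on-affine-equation : ∀ a → 𝟙 (onGraph (hyperplane a) (y₀ ∷ y))
                               ≡ 𝟙 (does (y₀ ≟ (toℕ z₀ + dot (toℕs a) (direction y)) mod p))
      on-affine-equation a = cong (λ x → 𝟙 (does (y₀ ≟ x mod p))) (eval-hyperplane a y)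
    ... | yes refl with y₀ ≟ z₀
    ...   | yes refl = begin
      graphCount (z₀ ∷ z)
        ≤⟨ ∑-mono-≤ (allPoints p (suc j)) (λ a → 𝟙≤1 (onGraph (hyperplane a) (z₀ ∷ z))) ⟩
      ∑[ _ ∈ allPoints p (suc j) ] 1       ≡⟨ ∑-allPoints-const {p} (suc j) 1 ⟩
      p ^ suc j * 1                        ≡⟨ *-identityʳ (p ^ suc j) ⟩
      p ^ j + q * p ^ j                    ≡⟨ cong (p ^ j +_) (*-identityˡ (q * p ^ j)) ⟨
      p ^ j + 1 * (q * p ^ j)              ∎
      where open ≤-Reasoning
    ...   | no y₀≢z₀ =
      ≤-trans (≤-reflexive (trans (∑-cong (allPoints p (suc j)) off-graph) (∑-zero (allPoints p (suc j))))) z≤n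
      where
      off-graph : ∀ a → 𝟙 (onGraph (hyperplane a) (y₀ ∷ z)) ≡ 0
      off-graph a = cong 𝟙 (trans (cong (λ x → does (y₀ ≟ x)) (hyperplane-through a)) (dec-false (y₀ ≟ z₀) y₀≢z₀))

    ∑-restricted-≤ : ∀ {c} (Qs : Fin c → Poly (suc (suc j))) →
      ∑[ a ∈ allPoints p (suc j) ] numCommonZeros p (suc j) c (substFirst (hyperplane a) ∘ Qs)
        ≤ p ^ j * numCommonZeros p (suc (suc j)) c Qs + q * p ^ j
    ∑-restricted-≤ {c} Qs = begin
      ∑[ a ∈ A ] numCommonZeros p (suc j) c (substFirst (hyperplane a) ∘ Qs)
        ≡⟨ ∑-cong A (λ a → numCommonZeros-substFirst (hyperplane a) Qs) ⟩
      ∑[ a ∈ A ] ∑[ y ∈ Y ] 𝟙 (onGraph (hyperplane a) y) * g y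
        ≡⟨ ∑-swap A Y (λ a y → 𝟙 (onGraph (hyperplane a) y) * g y) ⟩
      ∑[ y ∈ Y ] ∑[ a ∈ A ] 𝟙 (onGraph (hyperplane a) y) * g y
        ≡⟨ ∑-cong Y (λ y → ∑-*ʳ A (g y) (λ a → 𝟙 (onGraph (hyperplane a) y))) ⟩
      ∑[ y ∈ Y ] graphCount y * g y
        ≤⟨ ∑-mono-≤ Y bound ⟩
      ∑[ y ∈ Y ] p ^ j * g y + δ y * (q * p ^ j)
        ≡⟨ ∑-+ Y (λ y → p ^ j * g y) (λ y → δ y * (q * p ^ j)) ⟩
      (∑[ y ∈ Y ] p ^ j * g y) + (∑[ y ∈ Y ] δ y * (q * p ^ j))
        ≡⟨ cong₂ _+_ (trans (∑-*ˡ Y (p ^ j) g) (cong (p ^ j *_) (sym (countTrue≡∑𝟙 (isCommonZeroᵇ {p} Qs) Y))))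
                     (∑-allPoints-δ (z₀ ∷ z) (λ _ → q * p ^ j)) ⟩
      p ^ j * numCommonZeros p (suc (suc j)) c Qs + q * p ^ j ∎
      where
      open ≤-Reasoning
      A = allPoints p (suc j)
      Y = allPoints p (suc (suc j))
      g : Vec (Fin p) (suc (suc j)) → ℕ
      g y = 𝟙 (isCommonZeroᵇ {p} Qs y)
      δ : Vec (Fin p) (suc (suc j)) → ℕ
      δ y = 𝟙 (does (y ≟ᵥ (z₀ ∷ z)))
      drop-g : ∀ y → δ y * (q * p ^ j) * g y ≤ δ y * (q * p ^ j)
      drop-g y = ≤-trans (*-monoʳ-≤ (δ y * (q * p ^ j)) (𝟙≤1 (isCommonZeroᵇ {p} Qs y))) (≤-reflexive (*-identityʳ _))
      bound : ∀ y → graphCount y * g y ≤ p ^ j * g y + δ y * (q * p ^ j)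
      bound y = begin
        graphCount y * g y                          ≤⟨ *-monoˡ-≤ (g y) (graphCount-≤ y) ⟩
        (p ^ j + δ y * (q * p ^ j)) * g y           ≡⟨ *-distribʳ-+ (g y) (p ^ j) _ ⟩
        p ^ j * g y + δ y * (q * p ^ j) * g y       ≤⟨ +-monoʳ-≤ (p ^ j * g y) (drop-g y) ⟩
        p ^ j * g y + δ y * (q * p ^ j)             ∎

    averaging : ∀ {c e} (Qs : Fin c → Poly (suc (suc j))) →
      (∀ a → q * p ^ e + 1 ≤ numCommonZeros p (suc j) c (substFirst (hyperplane a) ∘ Qs)) →
      q * p ^ suc e + 1 ≤ numCommonZeros p (suc (suc j)) c Qs
    averaging {c} {e} Qs restricted-≥ =
      +-cancelʳ-≤ q _ _ (*-cancelˡ-≤ (p ^ j) {{m^n≢0 p j}} (begin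
        p ^ j * (q * p ^ suc e + 1 + q)
          ≡⟨ cong (p ^ j *_) (expand q (p ^ e)) ⟨
        p ^ j * (p * (q * p ^ e + 1))
          ≡⟨ trans (*-CS.x∙yz≈y∙xz (p ^ j) p _) (sym (*-assoc p (p ^ j) _)) ⟩
        p ^ suc j * (q * p ^ e + 1)
          ≡⟨ ∑-allPoints-const {p} (suc j) (q * p ^ e + 1) ⟨
        ∑[ a ∈ allPoints p (suc j) ] q * p ^ e + 1
          ≤⟨ ∑-mono-≤ (allPoints p (suc j)) restricted-≥ ⟩
        ∑[ a ∈ allPoints p (suc j) ] numCommonZeros p (suc j) c (substFirst (hyperplane a) ∘ Qs)
          ≤⟨ ∑-restricted-≤ Qs ⟩
        p ^ j * N + q * p ^ j
          ≡⟨ cong (p ^ j * N +_) (*-comm q (p ^ j)) ⟩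
        p ^ j * N + p ^ j * q
          ≡⟨ *-distribˡ-+ (p ^ j) N q ⟨
        p ^ j * (N + q) ∎))
      where
      open ≤-Reasoning
      N = numCommonZeros p (suc (suc j)) c Qs
      expand : ∀ q x → suc q * (q * x + 1) ≡ q * (suc q * x) + 1 + q
      expand = solve-∀

  1≤numCommonZeros : ∀ {m c} (Qs : Fin c → Poly m) (z : Vec (Fin p) m) →
    isCommonZeroᵇ {p} Qs z ≡ true → 1 ≤ numCommonZeros p m c Qs
  1≤numCommonZeros {m} {c} Qs z z-zero = begin
    1                                 ≡⟨ cong 𝟙 z-zero ⟨
    g z                               ≡⟨ ∑-allPoints-δ z g ⟨
    ∑[ y ∈ allPoints p m ] δ y * g y  ≤⟨ ∑-mono-≤ (allPoints p m) δg≤g ⟩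
    ∑[ y ∈ allPoints p m ] g y        ≡⟨ countTrue≡∑𝟙 (isCommonZeroᵇ {p} Qs) (allPoints p m) ⟨
    numCommonZeros p m c Qs           ∎
    where
    open ≤-Reasoning
    g : Vec (Fin p) m → ℕ
    g y = 𝟙 (isCommonZeroᵇ {p} Qs y)
    δ : Vec (Fin p) m → ℕ
    δ y = 𝟙 (does (y ≟ᵥ z))
    δg≤g : ∀ y → δ y * g y ≤ g y
    δg≤g y = ≤-trans (*-monoˡ-≤ (g y) (𝟙≤1 (does (y ≟ᵥ z)))) (≤-reflexive (+-identityʳ (g y)))

  q*p^[m∸[1+cd]]+1≤numCommonZeros : ∀ {m c d} (Qs : Fin c → Poly m) → (∀ j → DegreeAtMost d (Qs j)) →
    c * d < m → (z : Vec (Fin p) m) → isCommonZeroᵇ {p} Qs z ≡ true →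
    q * p ^ (m ∸ suc (c * d)) + 1 ≤ numCommonZeros p m c Qs
  q*p^[m∸[1+cd]]+1≤numCommonZeros {suc m} {c} {d} Qs degQs (s≤s cd≤m) (z₀ ∷ z) z-zero with c * d <? m
  ... | no cd≮m = begin
    q * p ^ (m ∸ c * d) + 1        ≡⟨ cong (λ e → q * p ^ e + 1) (m≤n⇒m∸n≡0 (≮⇒≥ cd≮m)) ⟩
    q * 1 + 1                      ≡⟨ trans (cong (_+ 1) (*-identityʳ q)) (+-comm q 1) ⟩
    p                              ≤⟨ ∣⇒≤ {{>-nonZero (1≤numCommonZeros Qs (z₀ ∷ z) z-zero)}} p∣N ⟩
    numCommonZeros p (suc m) c Qs  ∎
    where
    open ≤-Reasoning
    p∣N = chevalley-warning Qs degQs (s≤s cd≤m)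
  ... | yes cd<m@(s≤s _) =
    subst (λ e → q * p ^ e + 1 ≤ numCommonZeros p (suc m) c Qs) (sym (+-∸-assoc 1 cd<m))
          (averaging {e = m ∸ suc (c * d)} Qs restricted-bound)
    where
    open Hyperplanes z₀ z
    restricted-zero : ∀ a → isCommonZeroᵇ {p} (substFirst (hyperplane a) ∘ Qs) z ≡ true
    restricted-zero a = trans (isCommonZeroᵇ-substFirst (hyperplane a) Qs z)
                              (trans (cong (λ x → isCommonZeroᵇ {p} Qs (x ∷ z)) (hyperplane-through a)) z-zero)
    restricted-bound : ∀ a →
      q * p ^ (m ∸ suc (c * d)) + 1 ≤ numCommonZeros p m c (substFirst (hyperplane a) ∘ Qs)
    restricted-bound a = q*p^[m∸[1+cd]]+1≤numCommonZeros (substFirst (hyperplane a) ∘ Qs)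
      (λ i → deg-substFirst (hyperplane a) (deg-affine _ _) (degQs i)) cd<m z (restricted-zero a)

  p^[m∸[1+cd]]≤numCommonZeros : ∀ {m c d} (Qs : Fin c → Poly m) → (∀ j → DegreeAtMost d (Qs j)) →
    (z : Vec (Fin p) m) → isCommonZeroᵇ {p} Qs z ≡ true → p ^ (m ∸ suc (c * d)) ≤ numCommonZeros p m c Qs
  p^[m∸[1+cd]]≤numCommonZeros {m} {c} {d} Qs degQs z z-zero with c * d <? m
  ... | yes cd<m = begin
    p ^ e                    ≤⟨ m≤n*m (p ^ e) q ⟩
    q * p ^ e                ≤⟨ m≤m+n (q * p ^ e) 1 ⟩
    q * p ^ e + 1            ≤⟨ q*p^[m∸[1+cd]]+1≤numCommonZeros Qs degQs cd<m z z-zero ⟩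
    numCommonZeros p m c Qs  ∎
    where
    open ≤-Reasoning
    e = m ∸ suc (c * d)
  ... | no cd≮m = begin
    p ^ (m ∸ suc (c * d))    ≡⟨ cong (p ^_) (m≤n⇒m∸n≡0 (≤-trans (≮⇒≥ cd≮m) (n≤1+n (c * d)))) ⟩
    1                        ≤⟨ 1≤numCommonZeros Qs z z-zero ⟩
    numCommonZeros p m c Qs  ∎
    where open ≤-Reasoning

corollary5p3 : (c d : ℕ) → ∃[ C ] ((p : ℕ) → Prime p → (n : ℕ) → (Ps : Fin c → Poly n) → ((j : Fin c) → DegreeAtMost d (Ps j)) → (∃[ x ] IsCommonZero {p} Ps x) → p ^ (n ∸ C) ≤ numCommonZeros p n c Ps)
corollary5p3 c d = suc (c * d) , bound
  where
  bound : (p : ℕ) → Prime p → (n : ℕ) → (Ps : Fin c → Poly n) → ((j : Fin c) → DegreeAtMost d (Ps j)) →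
          (∃[ x ] IsCommonZero {p} Ps x) → p ^ (n ∸ suc (c * d)) ≤ numCommonZeros p n c Ps
  bound zero    p-prime = contradiction p-prime ¬prime[0]
  bound (suc q) p-prime n Ps degPs (x , x-zero) =
    PrimeField.p^[m∸[1+cd]]≤numCommonZeros q p-prime Ps degPs x (IsCommonZero⇒isCommonZeroᵇ Ps x x-zero)
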